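{- Let $\mathcal{P},\mathcal{P}'$ be LR-vines and let $\varphi\colon\mathcal{P}\to\mathcal{P}'$ be a rank-preserving poset homomorphism that preserves joins of minimal pairs, i.e. whenever $x,y$ are minimal elements of $\mathcal{P}$ such that the join $x\vee y$ exists, then $\varphi(x)\vee\varphi(y)$ exists and $\varphi(x\vee y)=\varphi(x)\vee\varphi(y)$. Then for every $v\in\mathcal{P}$, $\varphi$ restricts to a poset isomorphism $\mathcal{P}_{\le v}\to\mathcal{P}'_{\le\varphi(v)}$.
   Context: Posets are finite. A graded poset has a rank function $\operatorname{rk}\colon\mathcal{P}\to\mathbb{Z}_{>0}$ with $x<y\Rightarrow\operatorname{rk}(x)<\operatorname{rk}(y)$, $\operatorname{rk}(y)=\operatorname{rk}(x)+1$ when $y$ covers $x$, and minimal elements of rank $1$; $\mathcal{P}_i$ = elements of rank $i$, $\dim(\mathcal{P})$ = number of minimal elements, $\mathcal{E}(v)$ = elements covered by $v$. A vine is a graded poset in which every non-minimal element covers exactly two elements, any two distinct elements of the same rank are covered by at most one common element, and for each $1\le i\le\operatorname{rk}(\mathcal{P})$ the graph $F_i$ on $\mathcal{P}_i$ with edge set $\{\mathcal{E}(v)\mid v\in\mathcal{P}_{i+1}\}$ is a forest. An R-vine is a vine with $\operatorname{rk}(\mathcal{P})=\dim(\mathcal{P})$, each $F_i$ a tree, and proximity: distinct elements of the same rank $i\ge2$ covered by a common element cover a common element. An LR-vine is a vine all of whose principal ideals $\mathcal{P}_{\le v}=\{x\mid x\le v\}$ (induced order and rank) are R-vines. A poset homomorphism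 is an order-preserving map; it is rank-preserving if $\operatorname{rk}'(\varphi(x))=\operatorname{rk}(x)$ for all $x$; an isomorphism is a bijective homomorphism whose inverse is a homomorphism. -}

module Defs where

open import Data.Nat using (ℕ; zero; suc; _≤_; _<_)
open import Data.Fin using (Fin; inject₁; fromℕ) renaming (zero to fzero; suc to fsuc)
open import Data.Product using (Σ; ∃; _×_; _,_)
open import Data.Sum using (_⊎_)
open import Data.Unit using (⊤)
open import Relation.Nullary using (¬_)
open import Relation.Binary.PropositionalEquality using (_≡_; _≢_)
open import Relation.Binary.Structures using (IsPartialOrder)
open import Relation.Binary.Construct.Closure.ReflexiveTransitive using (Star)
open import Function.Definitions using (Injective)

module Graph {A : Set} (V : A → Set) (E : A → A → Set) where

  -- A cycle: pairwise distinct vertices c 0, …, c k (k ≥ 2, i.e. at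
  -- least 3 vertices), consecutive ones adjacent, and c k adjacent to c 0.
  record Cycle : Set where
    field
      k      : ℕ
      long   : 2 ≤ k
      c      : Fin (suc k) → A
      inj    : Injective _≡_ _≡_ c
      inV    : ∀ i → V (c i)
      step   : ∀ (i : Fin k) → E (c (inject₁ i)) (c (fsuc i))
      close  : E (c (fromℕ k)) (c fzero)

  IsForest : Set
  IsForest = ¬ Cycle

  Adj : A → A → Set
  Adj a b = V a × V b × E a b

  IsConnected : Set
  IsConnected = ∀ x y → V x → V y → Star Adj x y

  IsTree : Set
  IsTree = IsForest × IsConnected

module Sub {A : Set} (_⊑_ : A → A → Set) (rk : A → ℕ) (S : A → Set) where

  _⊏_ : A → A → Set
  x ⊏ y = x ⊑ y × x ≢ y

  Covers : A → A → Set
  Covers y x = x ⊏ y × ¬ (Σ A λ z → S z × x ⊏ z × z ⊏ y)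

  Minimal : A → Set
  Minimal x = S x × (∀ y → S y → y ⊑ x → y ≡ x)

  IsGraded : Set
  IsGraded =
      (∀ x → S x → 0 < rk x)
    × (∀ x y → S x → S y → x ⊏ y → rk x < rk y)
    × (∀ x y → S x → S y → Covers y x → rk y ≡ suc (rk x))
    × (∀ x → Minimal x → rk x ≡ 1)

  -- rk(S) = d : the maximal rank (0 for the empty poset)
  HasRank : ℕ → Set
  HasRank d = (∀ x → S x → rk x ≤ d) × (d ≡ 0 ⊎ Σ A λ x → S x × rk x ≡ d)

  HasDim : ℕ → Set
  HasDim d = Σ (Fin d → A) λ f →
      Injective _≡_ _≡_ f
    × (∀ i → Minimal (f i))
    × (∀ x → Minimal x → Σ (Fin d) λ i → f i ≡ x)

  Vert : ℕ → A → Set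
  Vert i a = S a × rk a ≡ i

  Edge : ℕ → A → A → Set
  Edge i a b = a ≢ b × Σ A λ v → S v × rk v ≡ suc i × Covers v a × Covers v b

  module F (i : ℕ) = Graph (Vert i) (Edge i)

  CoversExactlyTwo : Set
  CoversExactlyTwo = ∀ v → S v → ¬ Minimal v →
    Σ A λ a → Σ A λ b → a ≢ b × S a × S b × Covers v a × Covers v b
      × (∀ c → S c → Covers v c → c ≡ a ⊎ c ≡ b)

  AtMostOneCommonCover : Set
  AtMostOneCommonCover = ∀ x y u w → S x → S y → S u → S w →
    x ≢ y → rk x ≡ rk y →
    Covers u x → Covers u y → Covers w x → Covers w y → u ≡ w

  IsVine : Set
  IsVine = IsGraded × CoversExactlyTwo × AtMostOneCommonCover
    × (∀ d → HasRank d → ∀ i → 1 ≤ i → i ≤ d → F.IsForest i)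

  Proximity : Set
  Proximity = ∀ x y → S x → S y → 2 ≤ rk x → rk x ≡ rk y → x ≢ y →
    (Σ A λ v → S v × Covers v x × Covers v y) →
    Σ A λ z → S z × Covers x z × Covers y z

  IsRVine : Set
  IsRVine = IsVine × Σ ℕ λ d → HasRank d × HasDim d
    × (∀ i → 1 ≤ i → i ≤ d → F.IsTree i) × Proximity

record RankedPoset : Set₁ where
  field
    n              : ℕ
    _⊑_            : Fin n → Fin n → Set
    isPartialOrder : IsPartialOrder _≡_ _⊑_
    rk             : Fin n → ℕ

  whole : Fin n → Set
  whole _ = ⊤

  ideal : Fin n → Fin n → Set
  ideal v x = x ⊑ v

  open Sub _⊑_ rk whole public

  IsLRVine : Set
  IsLRVine = IsVine × (∀ v → Sub.IsRVine _⊑_ rk (ideal v))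

  IsJoin : Fin n → Fin n → Fin n → Set
  IsJoin x y j = x ⊑ j × y ⊑ j × (∀ u → x ⊑ u → y ⊑ u → j ⊑ u)

module _ (P P' : RankedPoset) where
  private
    module P = RankedPoset P
    module Q = RankedPoset P'

  IsHomomorphism : (Fin P.n → Fin Q.n) → Set
  IsHomomorphism φ = ∀ x y → P._⊑_ x y → Q._⊑_ (φ x) (φ y)

  IsRankPreserving : (Fin P.n → Fin Q.n) → Set
  IsRankPreserving φ = ∀ x → Q.rk (φ x) ≡ P.rk x

  PreservesMinimalJoins : (Fin P.n → Fin Q.n) → Set
  PreservesMinimalJoins φ = ∀ x y j → P.Minimal x → P.Minimal y →
    P.IsJoin x y j → Q.IsJoin (φ x) (φ y) (φ j)

  RestrictsToIso : (Fin P.n → Fin Q.n) → Fin P.n → Set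
  RestrictsToIso φ v =
      (∀ x → P._⊑_ x v → Q._⊑_ (φ x) (φ v))
    × (∀ x y → P._⊑_ x v → P._⊑_ y v → φ x ≡ φ y → x ≡ y)
    × (∀ y → Q._⊑_ y (φ v) → Σ (Fin P.n) λ x → P._⊑_ x v × φ x ≡ y)
    × (∀ x y → P._⊑_ x v → P._⊑_ y v → P._⊑_ x y → Q._⊑_ (φ x) (φ y))
    × (∀ x y → P._⊑_ x v → P._⊑_ y v → Q._⊑_ (φ x) (φ y) → P._⊑_ x y)

-- A rank-preserving homomorphism maps covers to covers. Injectivity on a
-- principal ideal is proved by induction on rank: for minimal x, y with
-- φ x = φ y the element φ (x ∨ y) = φ x has rank 1, so x ∨ y is minimal and
-- x = x ∨ y = y; in the inductive step, φ p = φ q forces the two lower covers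
-- of q to be lower covers of p, and in a vine two distinct elements of equal
-- rank have at most one common cover. Surjectivity onto P'_{≤ φ v} follows by
-- descending along lower covers, since those of φ v are the images of those
-- of v. Joins of equal-rank elements exist in an LR-vine: along a path from p
-- to q in the tree F_i(P_{≤ w}), the first step p — s goes through a cover u
-- of p lying below every common upper bound t of p and q, because a path from
-- p to q in F_i(P_{≤ t}) followed by the rest of the first path back to s
-- closes a cycle in the forest F_i(P) unless it is the edge through u.

module Submission where

open import Defs
open import Data.Empty using (⊥-elim)
open import Data.Fin using (Fin; inject₁; fromℕ; _≟_) renaming (zero to fzero; suc to fsuc)
open import Data.Fin.Properties using (any?)
open import Data.List using (allFin)
open import Data.List.Extrema.Nat using (argmax; f[⊥]≤f[argmax]; f[xs]≤f[argmax])
open import Data.List.Membership.Propositional.Properties using (∈-allFin)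
open import Data.List.Relation.Unary.All using (lookup)
open import Data.Nat using (ℕ; zero; suc; _+_; _≤_; _<_; s≤s; z≤n)
open import Data.Nat.Properties
  using (suc-injective; ≤-refl; ≤-antisym; ≤-trans; <-irrefl; ≤-<-trans; <⇒≤; <⇒≢; <⇒≱; n<1+n; +-suc; m≤n+m; m∸n+n≡m)
open import Data.Product using (Σ; _×_; _,_; proj₁; proj₂)
open import Data.Sum using (_⊎_; inj₁; inj₂; swap; [_,_]′)
open import Data.Unit using (⊤; tt)
open import Function using (_∘_)
open import Function.Definitions using (Injective)
open import Relation.Nullary using (¬_; yes; no)
open import Relation.Binary.PropositionalEquality using (_≡_; _≢_; refl; sym; trans; subst; cong; ≢-sym)
open import Relation.Binary.Definitions using (DecidableEquality)
open import Relation.Binary.Structures using (IsPartialOrder)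
open import Relation.Binary.Construct.Closure.ReflexiveTransitive
  using (Star; ε; _◅_; _◅◅_; reverse) renaming (map to starMap)

module Walk {A : Set} {R : A → A → Set} where

  length : ∀ {x y} → Star R x y → ℕ
  length ε       = 0
  length (_ ◅ w) = suc (length w)

  vertex : ∀ {x y} (w : Star R x y) → Fin (suc (length w)) → A
  vertex {x} ε       _        = x
  vertex {x} (_ ◅ w) fzero    = x
  vertex     (_ ◅ w) (fsuc i) = vertex w i

  vertex-first : ∀ {x y} (w : Star R x y) → vertex w fzero ≡ x
  vertex-first ε       = refl
  vertex-first (_ ◅ w) = refl

  vertex-last : ∀ {x y} (w : Star R x y) → vertex w (fromℕ (length w)) ≡ y
  vertex-last ε       = refl
  vertex-last (_ ◅ w) = vertex-last w

  Avoids : ∀ {x y} → A → Star R x y → Set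
  Avoids a w = ∀ i → vertex w i ≢ a

  IsPath : ∀ {x y} → Star R x y → Set
  IsPath ε           = ⊤
  IsPath {x} (_ ◅ w) = Avoids x w × IsPath w

  vertex-injective : ∀ {x y} (w : Star R x y) → IsPath w → Injective _≡_ _≡_ (vertex w)
  vertex-injective ε       _              {fzero}  {fzero}  _ = refl
  vertex-injective (_ ◅ w) _              {fzero}  {fzero}  _ = refl
  vertex-injective (_ ◅ w) (avoids , _)   {fzero}  {fsuc j} e = ⊥-elim (avoids j (sym e))
  vertex-injective (_ ◅ w) (avoids , _)   {fsuc i} {fzero}  e = ⊥-elim (avoids i e)
  vertex-injective (_ ◅ w) (_ , isPath)   {fsuc i} {fsuc j} e = cong fsuc (vertex-injective w isPath e)

  suffix : ∀ {x y} (w : Star R x y) (i : Fin (suc (length w))) → Star R (vertex w i) y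
  suffix ε       fzero    = ε
  suffix (r ◅ w) fzero    = r ◅ w
  suffix (_ ◅ w) (fsuc i) = suffix w i

  suffix-isPath : ∀ {x y} (w : Star R x y) i → IsPath w → IsPath (suffix w i)
  suffix-isPath ε       fzero    isPath       = isPath
  suffix-isPath (_ ◅ w) fzero    isPath       = isPath
  suffix-isPath (_ ◅ w) (fsuc i) (_ , isPath) = suffix-isPath w i isPath

  toPath : DecidableEquality A → ∀ {x y} → Star R x y → Σ (Star R x y) IsPath
  toPath _≟ᴬ_ ε = ε , tt
  toPath _≟ᴬ_ {x} {y} (r ◅ w) with toPath _≟ᴬ_ w
  ... | p , isPath with any? (λ i → vertex p i ≟ᴬ x)
  ...   | yes (i , pᵢ≡x) = subst (λ a → Σ (Star R a y) IsPath) pᵢ≡x (suffix p i , suffix-isPath p i isPath)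
  ...   | no ¬visits     = r ◅ p , (λ i pᵢ≡x → ¬visits (i , pᵢ≡x)) , isPath

module _ {A : Set} {V : A → Set} {E R : A → A → Set}
         (R⇒E : ∀ {a b} → R a b → E a b) (E⇒V : ∀ {a b} → E a b → V a) where
  open Walk

  vertex-inV : ∀ {x y} (w : Star R x y) → V y → ∀ i → V (vertex w i)
  vertex-inV ε       vy _        = vy
  vertex-inV (r ◅ _) _  fzero    = E⇒V (R⇒E r)
  vertex-inV (_ ◅ w) vy (fsuc i) = vertex-inV w vy i

  vertex-step : ∀ {x y} (w : Star R x y) (i : Fin (length w)) → E (vertex w (inject₁ i)) (vertex w (fsuc i))
  vertex-step (r ◅ w) fzero    = subst (E _) (sym (vertex-first w)) (R⇒E r)
  vertex-step (_ ◅ w) (fsuc i) = vertex-step w i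

  forest-walk-to-neighbour⇒step : DecidableEquality A → Graph.IsForest V E →
    ∀ {x y} → Star R x y → x ≢ y → E y x → R x y
  forest-walk-to-neighbour⇒step _≟ᴬ_ forest {x} w x≢y y~x with toPath _≟ᴬ_ w
  ... | ε , _                   = ⊥-elim (x≢y refl)
  ... | r ◅ ε , _               = r
  ... | p@(_ ◅ _ ◅ _) , isPath = ⊥-elim (forest record
    { k     = length p
    ; long  = s≤s (s≤s z≤n)
    ; c     = vertex p
    ; inj   = vertex-injective p isPath
    ; inV   = vertex-inV p (E⇒V y~x)
    ; step  = vertex-step p
    ; close = subst (λ a → E a x) (sym (vertex-last p)) y~x
    })

module Graded (P : RankedPoset) (graded : RankedPoset.IsGraded P) where
  open RankedPoset P public
  open IsPartialOrder isPartialOrder public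
    using (antisym; reflexive) renaming (refl to ⊑-refl; trans to ⊑-trans)

  rk-pos : ∀ x → 0 < rk x
  rk-pos x = proj₁ graded x tt

  ⊑∧≢⇒rk< : ∀ {x y} → x ⊑ y → x ≢ y → rk x < rk y
  ⊑∧≢⇒rk< {x} {y} x⊑y x≢y = proj₁ (proj₂ graded) x y tt tt (x⊑y , x≢y)

  covers⇒rk≡suc : ∀ {x y} → Covers y x → rk y ≡ suc (rk x)
  covers⇒rk≡suc {x} {y} = proj₁ (proj₂ (proj₂ graded)) x y tt tt

  covers∧rk≡suc⇒rk≡ : ∀ {x y m} → Covers y x → rk y ≡ suc m → rk x ≡ m
  covers∧rk≡suc⇒rk≡ y⋗x rky = suc-injective (trans (sym (covers⇒rk≡suc y⋗x)) rky)

  covers⇒⊑ : ∀ {x y} → Covers y x → x ⊑ y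
  covers⇒⊑ = proj₁ ∘ proj₁

  covers⇒2≤rk : ∀ {x y} → Covers y x → 2 ≤ rk y
  covers⇒2≤rk {x} y⋗x = subst (2 ≤_) (sym (covers⇒rk≡suc y⋗x)) (s≤s (rk-pos x))

  ⊑⇒rk≤ : ∀ {x y} → x ⊑ y → rk x ≤ rk y
  ⊑⇒rk≤ {x} {y} x⊑y with x ≟ y
  ... | yes refl = ≤-refl
  ... | no x≢y   = <⇒≤ (⊑∧≢⇒rk< x⊑y x≢y)

  ⊑∧rk≡⇒≡ : ∀ {x y} → x ⊑ y → rk x ≡ rk y → x ≡ y
  ⊑∧rk≡⇒≡ {x} {y} x⊑y rkx≡rky with x ≟ y
  ... | yes x≡y = x≡y
  ... | no x≢y  = ⊥-elim (<⇒≢ (⊑∧≢⇒rk< x⊑y x≢y) rkx≡rky)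

  ⊑∧rk≡suc⇒covers : ∀ {x y} → x ⊑ y → rk y ≡ suc (rk x) → Covers y x
  ⊑∧rk≡suc⇒covers {x} {y} x⊑y rky = (x⊑y , x≢y) , λ (z , _ , (x⊑z , x≢z) , (z⊑y , z≢y)) →
    <-irrefl refl (≤-<-trans (subst (_≤ rk z) (sym rky) (⊑∧≢⇒rk< x⊑z x≢z)) (⊑∧≢⇒rk< z⊑y z≢y))
    where
      x≢y : x ≢ y
      x≢y refl = <⇒≢ (n<1+n (rk x)) rky

  rk≡1⇒minimal : ∀ {x} → rk x ≡ 1 → Minimal x
  rk≡1⇒minimal {x} rkx = tt , below-is-equal
    where
      below-is-equal : ∀ y → ⊤ → y ⊑ x → y ≡ x
      below-is-equal y _ y⊑x with y ≟ x
      ... | yes y≡x = y≡x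
      ... | no y≢x  = ⊥-elim (<⇒≱ (subst (rk y <_) rkx (⊑∧≢⇒rk< y⊑x y≢x)) (rk-pos y))

  minimal⇒rk≡1 : ∀ {x} → Minimal x → rk x ≡ 1
  minimal⇒rk≡1 {x} = proj₂ (proj₂ (proj₂ graded)) x

  2≤rk⇒¬minimal : ∀ {x} → 2 ≤ rk x → ¬ Minimal x
  2≤rk⇒¬minimal 2≤rkx minimal with subst (2 ≤_) (minimal⇒rk≡1 minimal) 2≤rkx
  ... | s≤s ()

module Vine (P : RankedPoset) (vine : RankedPoset.IsVine P) where
  open Graded P (proj₁ vine) public

  private
    covers-exactly-two : CoversExactlyTwo
    covers-exactly-two = proj₁ (proj₂ vine)
    at-most-one-common-cover : AtMostOneCommonCover
    at-most-one-common-cover = proj₁ (proj₂ (proj₂ vine))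
    forests : ∀ d → HasRank d → ∀ i → 1 ≤ i → i ≤ d → F.IsForest i
    forests = proj₂ (proj₂ (proj₂ vine))

  record Children (v : Fin n) : Set where
    field
      left right   : Fin n
      left≢right   : left ≢ right
      covers-left  : Covers v left
      covers-right : Covers v right

  children : ∀ v → 2 ≤ rk v → Children v
  children v 2≤rkv with covers-exactly-two v tt (2≤rk⇒¬minimal 2≤rkv)
  ... | a , b , a≢b , _ , _ , v⋗a , v⋗b , _ = record
    { left = a ; right = b ; left≢right = a≢b ; covers-left = v⋗a ; covers-right = v⋗b }

  covers-only-pair : ∀ {v a b c} → Covers v a → Covers v b → Covers v c → a ≢ b → c ≡ a ⊎ c ≡ b
  covers-only-pair {v} {a} {b} {c} v⋗a v⋗b v⋗c a≢b
    with covers-exactly-two v tt (2≤rk⇒¬minimal (covers⇒2≤rk v⋗a))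
  ... | _ , _ , _ , _ , _ , _ , _ , only with only a tt v⋗a | only b tt v⋗b | only c tt v⋗c
  ...   | inj₁ refl | inj₁ refl | _   = ⊥-elim (a≢b refl)
  ...   | inj₂ refl | inj₂ refl | _   = ⊥-elim (a≢b refl)
  ...   | inj₁ refl | inj₂ refl | c∈ = c∈
  ...   | inj₂ refl | inj₁ refl | c∈ = swap c∈

  common-cover-unique : ∀ {x y u w} → x ≢ y → rk x ≡ rk y →
    Covers u x → Covers u y → Covers w x → Covers w y → u ≡ w
  common-cover-unique {x} {y} {u} {w} = at-most-one-common-cover x y u w tt tt tt tt

  F-forest : ∀ x → F.IsForest (rk x)
  F-forest x = forests (rk top) (bounded , inj₂ (top , tt , refl)) (rk x) (rk-pos x) (f[⊥]≤f[argmax] {f = rk} x (allFin n))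
    where
      top : Fin n
      top = argmax rk x (allFin n)
      bounded : ∀ y → ⊤ → rk y ≤ rk top
      bounded y _ = lookup (f[xs]≤f[argmax] {f = rk} x (allFin n)) (∈-allFin y)

module LRVine (P : RankedPoset) (lr : RankedPoset.IsLRVine P) where
  open Vine P (proj₁ lr) public
  open Walk

  module Ideal (w : Fin n) = Sub _⊑_ rk (ideal w)

  IdealAdj : Fin n → ℕ → Fin n → Fin n → Set
  IdealAdj w i = Graph.Adj (Ideal.Vert w i) (Ideal.Edge w i)

  ideal-covers⇒covers : ∀ {w y x} → y ⊑ w → Ideal.Covers w y x → Covers y x
  ideal-covers⇒covers y⊑w (x⊏y , none) =
    x⊏y , λ (z , _ , x⊏z , z⊏y) → none (z , ⊑-trans (proj₁ z⊏y) y⊑w , x⊏z , z⊏y)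

  ideal-rank≡rk : ∀ {w d} → Ideal.HasRank w d → d ≡ rk w
  ideal-rank≡rk {w} (bounded , inj₁ refl)               = ⊥-elim (<⇒≱ (rk-pos w) (bounded w ⊑-refl))
  ideal-rank≡rk {w} (bounded , inj₂ (x , x⊑w , refl)) = ≤-antisym (⊑⇒rk≤ x⊑w) (bounded w ⊑-refl)

  ideal-connected : ∀ {w p q} → p ⊑ w → q ⊑ w → rk p ≡ rk q → Star (IdealAdj w (rk p)) p q
  ideal-connected {w} {p} {q} p⊑w q⊑w rkp≡rkq with proj₂ (proj₂ lr w)
  ... | _ , hasRank , _ , trees , _ =
    proj₂ (trees (rk p) (rk-pos p) (subst (rk p ≤_) (sym (ideal-rank≡rk hasRank)) (⊑⇒rk≤ p⊑w)))
      p q (p⊑w , refl) (q⊑w , sym rkp≡rkq)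

  ideal-adj⇒edge : ∀ {w i a b} → IdealAdj w i a b → Edge i a b
  ideal-adj⇒edge (_ , _ , a≢b , u , u⊑w , rku , u⋗a , u⋗b) =
    a≢b , u , tt , rku , ideal-covers⇒covers u⊑w u⋗a , ideal-covers⇒covers u⊑w u⋗b

  ideal-adj-sym : ∀ {w i a b} → IdealAdj w i a b → IdealAdj w i b a
  ideal-adj-sym (va , vb , a≢b , u , u⊑w , rku , u⋗a , u⋗b) = vb , va , ≢-sym a≢b , u , u⊑w , rku , u⋗b , u⋗a

  edge-sym : ∀ {i a b} → Edge i a b → Edge i b a
  edge-sym (a≢b , u , _ , rku , u⋗a , u⋗b) = ≢-sym a≢b , u , tt , rku , u⋗b , u⋗a

  edge⇒vert : ∀ {i a b} → Edge i a b → Vert i a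
  edge⇒vert (_ , _ , _ , rku , u⋗a , _) = tt , suc-injective (trans (sym (covers⇒rk≡suc u⋗a)) rku)

  BelowOrAvoiding : Fin n → Fin n → ℕ → Fin n → Fin n → Set
  BelowOrAvoiding t p i a b = IdealAdj t i a b ⊎ (a ≢ p × b ≢ p × Edge i a b)

  below-or-avoiding-sym : ∀ {t p i a b} → BelowOrAvoiding t p i a b → BelowOrAvoiding t p i b a
  below-or-avoiding-sym (inj₁ adj)               = inj₁ (ideal-adj-sym adj)
  below-or-avoiding-sym (inj₂ (a≢p , b≢p , e)) = inj₂ (b≢p , a≢p , edge-sym e)

  below-or-avoiding⇒edge : ∀ {t p i a b} → BelowOrAvoiding t p i a b → Edge i a b
  below-or-avoiding⇒edge (inj₁ adj)       = ideal-adj⇒edge adj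
  below-or-avoiding⇒edge (inj₂ (_ , _ , e)) = e

  avoiding-walk : ∀ {w t p i a b} (τ : Star (IdealAdj w i) a b) → Avoids p τ → Star (BelowOrAvoiding t p i) a b
  avoiding-walk ε       _      = ε
  avoiding-walk (r ◅ τ) avoids =
    inj₂ (avoids fzero , subst (_≢ _) (vertex-first τ) (avoids (fsuc fzero)) , ideal-adj⇒edge r)
      ◅ avoiding-walk τ (avoids ∘ fsuc)

  first-step-below-upper-bounds : ∀ {w p q} → p ≢ q → p ⊑ w → q ⊑ w → rk p ≡ rk q →
    Σ (Fin n) λ u → u ⊑ w × Covers u p × (∀ t → p ⊑ t → q ⊑ t → u ⊑ t)
  first-step-below-upper-bounds {w} {p} {q} p≢q p⊑w q⊑w rkp≡rkq with toPath _≟_ (ideal-connected p⊑w q⊑w rkp≡rkq)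
  ... | ε , _ = ⊥-elim (p≢q refl)
  ... | _◅_ {j = s} step@(_ , (_ , rks) , p≢s , u , u⊑w , _ , u⋗′p , u⋗′s) τ , (τ-avoids-p , _) =
    u , u⊑w , u⋗p , below-upper-bound
    where
      u⋗p : Covers u p
      u⋗p = ideal-covers⇒covers u⊑w u⋗′p
      u⋗s : Covers u s
      u⋗s = ideal-covers⇒covers u⊑w u⋗′s

      walk-to-s : ∀ {t} → p ⊑ t → q ⊑ t → Star (BelowOrAvoiding t p (rk p)) p s
      walk-to-s p⊑t q⊑t = starMap inj₁ (ideal-connected p⊑t q⊑t rkp≡rkq)
        ◅◅ reverse below-or-avoiding-sym (avoiding-walk τ τ-avoids-p)

      below-upper-bound : ∀ t → p ⊑ t → q ⊑ t → u ⊑ t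
      below-upper-bound t p⊑t q⊑t
        with forest-walk-to-neighbour⇒step below-or-avoiding⇒edge edge⇒vert _≟_ (F-forest p)
               (walk-to-s p⊑t q⊑t) p≢s (edge-sym (ideal-adj⇒edge step))
      ... | inj₁ (_ , _ , _ , u′ , u′⊑t , _ , u′⋗p , u′⋗s) =
        subst (_⊑ t) (common-cover-unique p≢s (sym rks)
          (ideal-covers⇒covers u′⊑t u′⋗p) (ideal-covers⇒covers u′⊑t u′⋗s) u⋗p u⋗s) u′⊑t
      ... | inj₂ (p≢p , _) = ⊥-elim (p≢p refl)

  join-of-equal-rank : ∀ k {w p q} → p ⊑ w → q ⊑ w → rk p ≡ rk q → k + rk p ≡ rk w → Σ (Fin n) (IsJoin p q)
  join-of-equal-rank zero {w} p⊑w q⊑w _ rkp≡rkw =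
    w , p⊑w , q⊑w , λ t p⊑t _ → subst (_⊑ t) (⊑∧rk≡⇒≡ p⊑w rkp≡rkw) p⊑t
  join-of-equal-rank (suc k) {w} {p} {q} p⊑w q⊑w rkp≡rkq gap with p ≟ q
  ... | yes refl = p , ⊑-refl , ⊑-refl , λ _ p⊑t _ → p⊑t
  ... | no p≢q
    with first-step-below-upper-bounds p≢q p⊑w q⊑w rkp≡rkq
       | first-step-below-upper-bounds (≢-sym p≢q) q⊑w p⊑w (sym rkp≡rkq)
  ... | u , u⊑w , u⋗p , u-least | u′ , u′⊑w , u′⋗q , u′-least
    with join-of-equal-rank k u⊑w u′⊑w rku≡rku′ (trans (cong (k +_) (covers⇒rk≡suc u⋗p)) (trans (+-suc k (rk p)) gap))
    where
      rku≡rku′ : rk u ≡ rk u′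
      rku≡rku′ = trans (covers⇒rk≡suc u⋗p) (trans (cong suc rkp≡rkq) (sym (covers⇒rk≡suc u′⋗q)))
  ... | j , u⊑j , u′⊑j , j-least =
    j , ⊑-trans (covers⇒⊑ u⋗p) u⊑j , ⊑-trans (covers⇒⊑ u′⋗q) u′⊑j ,
    λ t p⊑t q⊑t → j-least t (u-least t p⊑t q⊑t) (u′-least t q⊑t p⊑t)

  join-exists : ∀ {w p q} → p ⊑ w → q ⊑ w → rk p ≡ rk q → Σ (Fin n) (IsJoin p q)
  join-exists p⊑w q⊑w rkp≡rkq = join-of-equal-rank _ p⊑w q⊑w rkp≡rkq (m∸n+n≡m (⊑⇒rk≤ p⊑w))

  below-at-rank : ∀ k {w} i → 1 ≤ i → k + i ≡ rk w → Σ (Fin n) λ z → z ⊑ w × rk z ≡ i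
  below-at-rank zero    {w} _ _   i≡rkw = w , ⊑-refl , sym i≡rkw
  below-at-rank (suc k) {w} i 1≤i gap =
    let (z , z⊑a , rkz) = below-at-rank k i 1≤i (sym (covers∧rk≡suc⇒rk≡ covers-left (sym gap)))
    in  z , ⊑-trans z⊑a (covers⇒⊑ covers-left) , rkz
    where open Children (children w (subst (2 ≤_) gap (s≤s (≤-trans 1≤i (m≤n+m i k)))))

  covered-within-from : ∀ {x a z w} → x ⊑ w → z ⊑ w → Covers z a → rk x ≡ rk a →
    Σ (Fin n) λ u → u ⊑ w × Covers u x
  covered-within-from {x} {a} x⊑w z⊑w z⋗a rkx≡rka with x ≟ a
  ... | yes refl = _ , z⊑w , z⋗a
  ... | no x≢a =
    let (u , u⊑w , u⋗x , _) = first-step-below-upper-bounds x≢a x⊑w (⊑-trans (covers⇒⊑ z⋗a) z⊑w) rkx≡rka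
    in  u , u⊑w , u⋗x

  covered-within : ∀ {x w} → x ⊑ w → rk x < rk w → Σ (Fin n) λ u → u ⊑ w × Covers u x
  covered-within {x} x⊑w rkx<rkw =
    let (z , z⊑w , rkz) = below-at-rank _ (suc (rk x)) (s≤s z≤n) (m∸n+n≡m rkx<rkw)
        open Children (children z (subst (2 ≤_) (sym rkz) (s≤s (rk-pos x))))
    in  covered-within-from x⊑w z⊑w covers-left (sym (covers∧rk≡suc⇒rk≡ covers-left rkz))

  below-lower-cover-of-gap : ∀ k {y w} → y ⊑ w → k + suc (rk y) ≡ rk w → Σ (Fin n) λ c → Covers w c × y ⊑ c
  below-lower-cover-of-gap zero    {y} y⊑w gap = y , ⊑∧rk≡suc⇒covers y⊑w (sym gap) , ⊑-refl
  below-lower-cover-of-gap (suc k) {y} y⊑w gap =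
    let (y′ , y′⊑w , y′⋗y) = covered-within y⊑w (subst (suc (rk y) ≤_) gap (m≤n+m (suc (rk y)) (suc k)))
        (c , w⋗c , y′⊑c)    = below-lower-cover-of-gap k y′⊑w
                                (trans (cong (λ r → k + suc r) (covers⇒rk≡suc y′⋗y))
                                  (trans (+-suc k (suc (rk y))) gap))
    in  c , w⋗c , ⊑-trans (covers⇒⊑ y′⋗y) y′⊑c

  below-lower-cover : ∀ {y w} → y ⊑ w → y ≢ w → Σ (Fin n) λ c → Covers w c × y ⊑ c
  below-lower-cover y⊑w y≢w = below-lower-cover-of-gap _ y⊑w (m∸n+n≡m (⊑∧≢⇒rk< y⊑w y≢w))

module Restriction
  (P P′ : RankedPoset) (lr : RankedPoset.IsLRVine P) (lr′ : RankedPoset.IsLRVine P′)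
  (φ : Fin (RankedPoset.n P) → Fin (RankedPoset.n P′))
  (φ-mono : IsHomomorphism P P′ φ) (φ-rk : IsRankPreserving P P′ φ) (φ-join : PreservesMinimalJoins P P′ φ)
  where
  open LRVine P lr
  module Q = LRVine P′ lr′

  φ≡⇒rk≡ : ∀ {x y} → φ x ≡ φ y → rk x ≡ rk y
  φ≡⇒rk≡ {x} {y} φx≡φy = trans (sym (φ-rk x)) (trans (cong Q.rk φx≡φy) (φ-rk y))

  φ-covers : ∀ {x y} → Covers y x → Q.Covers (φ y) (φ x)
  φ-covers {x} {y} y⋗x = Q.⊑∧rk≡suc⇒covers (φ-mono x y (covers⇒⊑ y⋗x))
    (trans (φ-rk y) (trans (covers⇒rk≡suc y⋗x) (cong suc (sym (φ-rk x)))))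

  InjectiveAtRank : ℕ → Set
  InjectiveAtRank k = ∀ {w x y} → x ⊑ w → y ⊑ w → rk x ≡ k → rk y ≡ k → φ x ≡ φ y → x ≡ y

  injective-at-rank-1 : InjectiveAtRank 1
  injective-at-rank-1 {x = x} x⊑w y⊑w rkx rky φx≡φy
    with join-exists x⊑w y⊑w (trans rkx (sym rky))
  ... | j , isJoin@(x⊑j , y⊑j , _)
    with φ-join _ _ j (rk≡1⇒minimal rkx) (rk≡1⇒minimal rky) isJoin
  ... | φx⊑φj , _ , φj-least =
    trans (proj₂ j-minimal _ tt x⊑j) (sym (proj₂ j-minimal _ tt y⊑j))
    where
      φj≡φx : φ j ≡ φ x
      φj≡φx = Q.antisym (φj-least _ Q.⊑-refl (Q.reflexive (sym φx≡φy))) φx⊑φj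
      j-minimal : Minimal j
      j-minimal = rk≡1⇒minimal (trans (φ≡⇒rk≡ φj≡φx) rkx)

  lower-cover-preimage : ∀ {m v c} → InjectiveAtRank m → rk v ≡ suc m →
    Q.Covers (φ v) c → Σ (Fin n) λ a → Covers v a × φ a ≡ c
  lower-cover-preimage {v = v} injective rkv φv⋗c =
    [ (λ c≡φl → left , covers-left , sym c≡φl) , (λ c≡φr → right , covers-right , sym c≡φr) ]′
      (Q.covers-only-pair (φ-covers covers-left) (φ-covers covers-right) φv⋗c φleft≢φright)
    where
      open Children (children v (subst (2 ≤_) (φ-rk v) (Q.covers⇒2≤rk φv⋗c)))
      φleft≢φright : φ left ≢ φ right
      φleft≢φright = left≢right ∘ injective (covers⇒⊑ covers-left) (covers⇒⊑ covers-right)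
        (covers∧rk≡suc⇒rk≡ covers-left rkv) (covers∧rk≡suc⇒rk≡ covers-right rkv)

  injective-at-suc-rank : ∀ m → InjectiveAtRank (suc m) → InjectiveAtRank (suc (suc m))
  injective-at-suc-rank m injective {w} {p} {q} p⊑w q⊑w rkp rkq φp≡φq =
    common-cover-unique left≢right (trans (rk-child covers-left) (sym (rk-child covers-right)))
      (covered-by-p covers-left) (covered-by-p covers-right) covers-left covers-right
    where
      open Children (children q (subst (2 ≤_) (sym rkq) (s≤s (s≤s z≤n))))
      rk-child : ∀ {a} → Covers q a → rk a ≡ suc m
      rk-child q⋗a = covers∧rk≡suc⇒rk≡ q⋗a rkq
      covered-by-p : ∀ {a} → Covers q a → Covers p a
      covered-by-p {a} q⋗a =
        let (b , p⋗b , φb≡φa) = lower-cover-preimage injective rkp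
                                  (subst (λ r → Q.Covers r (φ a)) (sym φp≡φq) (φ-covers q⋗a))
        in  subst (Covers p) (injective (⊑-trans (covers⇒⊑ p⋗b) p⊑w) (⊑-trans (covers⇒⊑ q⋗a) q⊑w)
              (covers∧rk≡suc⇒rk≡ p⋗b rkp) (rk-child q⋗a) φb≡φa) p⋗b

  injective-at-rank : ∀ k → InjectiveAtRank k
  injective-at-rank zero {x = x} _ _ rkx _ _ = ⊥-elim (<⇒≢ (rk-pos x) (sym rkx))
  injective-at-rank (suc zero)    = injective-at-rank-1
  injective-at-rank (suc (suc m)) = injective-at-suc-rank m (injective-at-rank (suc m))

  φ-injective-below : ∀ {w x y} → x ⊑ w → y ⊑ w → φ x ≡ φ y → x ≡ y
  φ-injective-below x⊑w y⊑w φx≡φy = injective-at-rank _ x⊑w y⊑w refl (sym (φ≡⇒rk≡ φx≡φy)) φx≡φy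

  φ-onto-ideal-at-rank : ∀ k {v} → rk v ≡ k → ∀ y → y Q.⊑ φ v → Σ (Fin n) λ x → x ⊑ v × φ x ≡ y
  φ-onto-ideal-at-rank zero {v} rkv _ _ = ⊥-elim (<⇒≢ (rk-pos v) (sym rkv))
  φ-onto-ideal-at-rank (suc k) {v} rkv y y⊑φv with y ≟ φ v
  ... | yes refl = v , ⊑-refl , refl
  ... | no y≢φv =
    let (c , φv⋗c , y⊑c)  = Q.below-lower-cover y⊑φv y≢φv
        (a , v⋗a , φa≡c) = lower-cover-preimage (injective-at-rank k) rkv φv⋗c
        (x , x⊑a , φx≡y) = φ-onto-ideal-at-rank k (covers∧rk≡suc⇒rk≡ v⋗a rkv) y (subst (y Q.⊑_) (sym φa≡c) y⊑c)
    in  x , ⊑-trans x⊑a (covers⇒⊑ v⋗a) , φx≡y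

  φ-onto-ideal : ∀ {v y} → y Q.⊑ φ v → Σ (Fin n) λ x → x ⊑ v × φ x ≡ y
  φ-onto-ideal = φ-onto-ideal-at-rank _ refl _

  φ-reflects-⊑ : ∀ {v x y} → x ⊑ v → y ⊑ v → φ x Q.⊑ φ y → x ⊑ y
  φ-reflects-⊑ x⊑v y⊑v φx⊑φy =
    let (x′ , x′⊑y , φx′≡φx) = φ-onto-ideal φx⊑φy
    in  subst (_⊑ _) (φ-injective-below (⊑-trans x′⊑y y⊑v) x⊑v φx′≡φx) x′⊑y

lemma6p4 : (P P' : RankedPoset) → RankedPoset.IsLRVine P → RankedPoset.IsLRVine P' →
    (φ : Fin (RankedPoset.n P) → Fin (RankedPoset.n P')) →
    IsHomomorphism P P' φ → IsRankPreserving P P' φ → PreservesMinimalJoins P P' φ →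
    ∀ v → RestrictsToIso P P' φ v
lemma6p4 P P' lr lr' φ φ-mono φ-rk φ-join v =
    (λ x → φ-mono x v)
  , (λ _ _ → φ-injective-below)
  , (λ _ → φ-onto-ideal)
  , (λ x y _ _ → φ-mono x y)
  , (λ _ _ → φ-reflects-⊑)
  where open Restriction P P' lr lr' φ φ-mono φ-rk φ-join
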